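{- Let $(h(n))_{n\in\mathbb{N}}$ be defined by $h(n)=1$ for all integers $n\le 1$ and $h(n)=h(n-h(n-1))+h(n-2)$ for $n>1$, and let $H(x)=\sum_{n=0}^\infty h(n)x^n$. Then $H$ satisfies the functional equation $$\frac{1}{1-x^2}H(x^2)-H(x)+\frac{x}{(1-x^2)^2}=0.$$
   Context: Identity of formal power series in $\mathbb{Z}[[x]]$. -}

module Defs where

open import Data.Nat as ℕ using (ℕ; zero; suc; _∸_)
open import Data.Integer using (ℤ; +_; _+_; _*_; -_; _-_; _≤_; _<_; 1ℤ; 0ℤ)
open import Data.Product using (_×_)
open import Relation.Binary.PropositionalEquality using (_≡_)

IsH : (ℤ → ℤ) → Set
IsH h = (∀ (n : ℤ) → n ≤ 1ℤ → h n ≡ 1ℤ)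
      × (∀ (n : ℤ) → 1ℤ < n → h n ≡ h (n - h (n - 1ℤ)) + h (n - + 2))

PS : Set
PS = ℕ → ℤ

sumTo : ℕ → (ℕ → ℤ) → ℤ
sumTo zero    f = f 0
sumTo (suc n) f = sumTo n f + f (suc n)

_⊕_ : PS → PS → PS
(f ⊕ g) n = f n + g n

⊖_ : PS → PS
(⊖ f) n = - f n

_⊛_ : PS → PS → PS
(f ⊛ g) n = sumTo n (λ k → f k * g (n ∸ k))

zeroPS : PS
zeroPS _ = 0ℤ

X : PS
X zero          = 0ℤ
X (suc zero)    = 1ℤ
X (suc (suc _)) = 0ℤ

-- substitution x ↦ x² : F(x) ↦ F(x²)
sq : PS → PS
sq f zero          = f 0
sq f (suc zero)    = 0ℤ
sq f (suc (suc n)) = sq (λ k → f (suc k)) n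

inv1-x² : PS
inv1-x² zero          = 1ℤ
inv1-x² (suc zero)    = 0ℤ
inv1-x² (suc (suc n)) = inv1-x² n

GF : (ℤ → ℤ) → PS
GF h n = h (+ n)

_≈PS_ : PS → PS → Set
f ≈PS g = ∀ n → f n ≡ g n

{-# OPTIONS --safe #-}
-- Since h(2j+1) = j+1 and h(2j+2) ≥ 2j+2, the self-referential recursion unwinds to
-- h(2j+2) = h(j+1) + h(2j) and h(2j+3) = h(2j+1) + 1, i.e. h(n+2) = h(n) + [x^(n+2)](H(x²) + x/(1-x²)).
-- The solution is built from this form by well-founded recursion, and any solution agrees with
-- it by strong induction. Multiplying the left-hand side E of the functional equation by 1 - x²
-- turns this recurrence into E(n+2) = E(n), and E(0) = E(1) = 0.
module Submission where

open import Data.Integer using (ℤ; +_; -[1+_]; _+_; _*_; -_; _-_; _≤_; _<_; 1ℤ; 0ℤ; +≤+; -≤+; +<+)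
import Data.Integer.Properties as ℤP
open import Data.Integer.Tactic.RingSolver using (solve-∀)
open import Data.Nat as ℕ using (ℕ; zero; suc; _∸_; z≤n; s≤s)
open import Data.Nat.Induction using (<-wellFounded; <-rec)
import Data.Nat.Properties as ℕP
open import Data.Product using (_×_; Σ; _,_; proj₁; ∃-syntax)
open import Data.Sum using (_⊎_; inj₁; inj₂)
open import Function using (_∘_)
open import Induction.WellFounded using (module FixPoint)
open import Relation.Binary.PropositionalEquality

open import Defs

sumTo-shift : ∀ n (f : ℕ → ℤ) → sumTo (suc n) f ≡ f 0 + sumTo n (f ∘ suc)
sumTo-shift zero    f = refl
sumTo-shift (suc n) f = trans (cong (_+ f (2 ℕ.+ n)) (sumTo-shift n f)) (ℤP.+-assoc (f 0) _ _)

sumTo-cong : ∀ n {f g : ℕ → ℤ} → (∀ k → k ℕ.≤ n → f k ≡ g k) → sumTo n f ≡ sumTo n g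
sumTo-cong zero    f≡g = f≡g 0 z≤n
sumTo-cong (suc n) f≡g = cong₂ _+_ (sumTo-cong n (λ k k≤n → f≡g k (ℕP.m≤n⇒m≤1+n k≤n))) (f≡g (suc n) ℕP.≤-refl)

sumTo-zero : ∀ n {f : ℕ → ℤ} → (∀ k → f k ≡ 0ℤ) → sumTo n f ≡ 0ℤ
sumTo-zero zero    f≡0 = f≡0 0
sumTo-zero (suc n) f≡0 = cong₂ _+_ (sumTo-zero n f≡0) (f≡0 (suc n))

X⊛-shift : ∀ (f : PS) n → (X ⊛ f) (suc n) ≡ f n
X⊛-shift f zero    = trans (ℤP.+-identityˡ _) (ℤP.*-identityˡ (f 0))
X⊛-shift f (suc n) = begin
  (X ⊛ f) (2 ℕ.+ n)                          ≡⟨ sumTo-shift (suc n) (λ k → X k * f (2 ℕ.+ n ∸ k)) ⟩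
  0ℤ * f (2 ℕ.+ n) + sumTo (suc n) (λ k → X (suc k) * f (suc n ∸ k))
    ≡⟨ cong (_+_ (0ℤ * f (2 ℕ.+ n))) (sumTo-shift n (λ k → X (suc k) * f (suc n ∸ k))) ⟩
  0ℤ * f (2 ℕ.+ n) + (1ℤ * f (suc n) + sumTo n (λ k → 0ℤ * f (n ∸ k)))
    ≡⟨ cong₂ (λ a b → 0ℤ * f (2 ℕ.+ n) + (a + b)) (ℤP.*-identityˡ (f (suc n))) (sumTo-zero n (λ k → ℤP.*-zeroˡ (f (n ∸ k)))) ⟩
  0ℤ * f (2 ℕ.+ n) + (f (suc n) + 0ℤ)                       ≡⟨ cong (_+_ (0ℤ * f (2 ℕ.+ n))) (ℤP.+-identityʳ (f (suc n))) ⟩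
  0ℤ * f (2 ℕ.+ n) + f (suc n)                              ≡⟨ cong (_+ f (suc n)) (ℤP.*-zeroˡ (f (2 ℕ.+ n))) ⟩
  0ℤ + f (suc n)                                            ≡⟨ ℤP.+-identityˡ _ ⟩
  f (suc n)                                                 ∎
  where open ≡-Reasoning

inv1-x²⊛-step : ∀ (f : PS) n → (inv1-x² ⊛ f) (2 ℕ.+ n) ≡ f (2 ℕ.+ n) + (inv1-x² ⊛ f) n
inv1-x²⊛-step f n = begin
  (inv1-x² ⊛ f) (2 ℕ.+ n)                    ≡⟨ sumTo-shift (suc n) (λ k → inv1-x² k * f (2 ℕ.+ n ∸ k)) ⟩
  1ℤ * f (2 ℕ.+ n) + sumTo (suc n) (λ k → inv1-x² (suc k) * f (suc n ∸ k))
    ≡⟨ cong (_+_ (1ℤ * f (2 ℕ.+ n))) (sumTo-shift n (λ k → inv1-x² (suc k) * f (suc n ∸ k))) ⟩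
  1ℤ * f (2 ℕ.+ n) + (0ℤ * f (suc n) + (inv1-x² ⊛ f) n)
    ≡⟨ cong₂ (λ a b → a + (b + (inv1-x² ⊛ f) n)) (ℤP.*-identityˡ (f (2 ℕ.+ n))) (ℤP.*-zeroˡ (f (suc n))) ⟩
  f (2 ℕ.+ n) + (0ℤ + (inv1-x² ⊛ f) n)                      ≡⟨ cong (_+_ (f (2 ℕ.+ n))) (ℤP.+-identityˡ _) ⟩
  f (2 ℕ.+ n) + (inv1-x² ⊛ f) n                             ∎
  where open ≡-Reasoning

⊛inv1-x²-step : ∀ (f : PS) n → (f ⊛ inv1-x²) (2 ℕ.+ n) ≡ (f ⊛ inv1-x²) n + f (2 ℕ.+ n)
⊛inv1-x²-step f n = begin
  sumTo n (λ k → f k * inv1-x² (2 ℕ.+ n ∸ k)) + f (suc n) * inv1-x² (suc n ∸ n) + f (2 ℕ.+ n) * inv1-x² (n ∸ n)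
    ≡⟨ cong₂ (λ a b → a + f (suc n) * inv1-x² b + f (2 ℕ.+ n) * inv1-x² (n ∸ n))
         (sumTo-cong n (λ k k≤n → cong (λ m → f k * inv1-x² m) (ℕP.+-∸-assoc 2 k≤n)))
         (ℕP.m+n∸n≡m 1 n) ⟩
  (f ⊛ inv1-x²) n + f (suc n) * 0ℤ + f (2 ℕ.+ n) * inv1-x² (n ∸ n)
    ≡⟨ cong₂ (λ a b → (f ⊛ inv1-x²) n + a + f (2 ℕ.+ n) * inv1-x² b) (ℤP.*-zeroʳ (f (suc n))) (ℕP.n∸n≡0 n) ⟩
  (f ⊛ inv1-x²) n + 0ℤ + f (2 ℕ.+ n) * 1ℤ
    ≡⟨ cong₂ _+_ (ℤP.+-identityʳ ((f ⊛ inv1-x²) n)) (ℤP.*-identityʳ (f (2 ℕ.+ n))) ⟩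
  (f ⊛ inv1-x²) n + f (2 ℕ.+ n)                             ∎
  where open ≡-Reasoning

sq-cong : ∀ {F G : PS} → F ≈PS G → sq F ≈PS sq G
sq-cong F≈G zero          = F≈G 0
sq-cong F≈G (suc zero)    = refl
sq-cong F≈G (suc (suc n)) = sq-cong (F≈G ∘ suc) n

series-identity : ∀ (F : PS) → F 0 ≡ 1ℤ → F 1 ≡ 1ℤ →
  (∀ n → F (2 ℕ.+ n) ≡ sq F (2 ℕ.+ n) + F n + inv1-x² (suc n)) →
  (((inv1-x² ⊛ sq F) ⊕ (⊖ F)) ⊕ ((X ⊛ inv1-x²) ⊛ inv1-x²)) ≈PS zeroPS
series-identity F F0≡1 F1≡1 recurrence = E≡0
  where
  open ≡-Reasoning

  E : PS
  E = ((inv1-x² ⊛ sq F) ⊕ (⊖ F)) ⊕ ((X ⊛ inv1-x²) ⊛ inv1-x²)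

  rearrange : ∀ s a f p q → s + a + - (s + f + p) + (q + p) ≡ a + - f + q
  rearrange = solve-∀

  E-periodic : ∀ n → E (2 ℕ.+ n) ≡ E n
  E-periodic n = begin
    (inv1-x² ⊛ sq F) (2 ℕ.+ n) + - F (2 ℕ.+ n) + ((X ⊛ inv1-x²) ⊛ inv1-x²) (2 ℕ.+ n)
      ≡⟨ cong₂ _+_ (cong₂ (λ a b → a + - b) (inv1-x²⊛-step (sq F) n) (recurrence n))
                   (trans (⊛inv1-x²-step (X ⊛ inv1-x²) n) (cong (_+_ (((X ⊛ inv1-x²) ⊛ inv1-x²) n)) (X⊛-shift inv1-x² (suc n)))) ⟩
    sq F (2 ℕ.+ n) + (inv1-x² ⊛ sq F) n + - (sq F (2 ℕ.+ n) + F n + inv1-x² (suc n))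
      + (((X ⊛ inv1-x²) ⊛ inv1-x²) n + inv1-x² (suc n))
      ≡⟨ rearrange (sq F (2 ℕ.+ n)) ((inv1-x² ⊛ sq F) n) (F n) (inv1-x² (suc n)) (((X ⊛ inv1-x²) ⊛ inv1-x²) n) ⟩
    E n ∎

  E≡0 : ∀ n → E n ≡ 0ℤ
  E≡0 zero          rewrite F0≡1 = refl
  E≡0 (suc zero)    rewrite F1≡1 = refl
  E≡0 (suc (suc n)) = trans (E-periodic n) (E≡0 n)

increment : ∀ n → (∀ {m} → m ℕ.< 2 ℕ.+ n → ℕ) → ℕ
increment zero          f = f (ℕP.n<1+n 1)
increment (suc zero)    f = 1
increment (suc (suc n)) f = increment n (λ m<2+n → f (ℕP.m<n⇒m<1+n (s≤s m<2+n)))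

increment-ext : ∀ n {f g : ∀ {m} → m ℕ.< 2 ℕ.+ n → ℕ} →
  (∀ {m} (m<2+n : m ℕ.< 2 ℕ.+ n) → f m<2+n ≡ g m<2+n) → increment n f ≡ increment n g
increment-ext zero          f≡g = f≡g _
increment-ext (suc zero)    f≡g = refl
increment-ext (suc (suc n)) f≡g = increment-ext n (λ _ → f≡g _)

increment-sq : ∀ (g : ℕ → ℕ) n →
  + increment n (λ {m} _ → g m) ≡ sq (λ k → + g k) (2 ℕ.+ n) + inv1-x² (suc n)
increment-sq g zero          = sym (ℤP.+-identityʳ (+ g 1))
increment-sq g (suc zero)    = refl
increment-sq g (suc (suc n)) = increment-sq (g ∘ suc) n

increment-even : ∀ (g : ℕ → ℕ) j → increment (j ℕ.+ j) (λ {m} _ → g m) ≡ g (suc j)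
increment-even g zero    = refl
increment-even g (suc j) rewrite ℕP.+-suc j j = increment-even (g ∘ suc) j

increment-odd : ∀ (g : ℕ → ℕ) j → increment (suc (j ℕ.+ j)) (λ {m} _ → g m) ≡ 1
increment-odd g zero    = refl
increment-odd g (suc j) rewrite ℕP.+-suc j j = increment-odd (g ∘ suc) j

increment-positive : ∀ (g : ℕ → ℕ) → (∀ m → 1 ℕ.≤ g m) → ∀ n → 1 ℕ.≤ increment n (λ {m} _ → g m)
increment-positive g g≥1 zero          = g≥1 1
increment-positive g g≥1 (suc zero)    = ℕP.≤-refl
increment-positive g g≥1 (suc (suc n)) = increment-positive (g ∘ suc) (g≥1 ∘ suc) n

hStep : ∀ n → (∀ {m} → m ℕ.< n → ℕ) → ℕ
hStep zero          _ = 1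
hStep (suc zero)    _ = 1
hStep (suc (suc n)) f = f (ℕP.m<n⇒m<1+n (ℕP.n<1+n n)) ℕ.+ increment n f

hStep-ext : ∀ n {f g : ∀ {m} → m ℕ.< n → ℕ} →
  (∀ {m} (m<n : m ℕ.< n) → f m<n ≡ g m<n) → hStep n f ≡ hStep n g
hStep-ext zero          f≡g = refl
hStep-ext (suc zero)    f≡g = refl
hStep-ext (suc (suc n)) f≡g = cong₂ ℕ._+_ (f≡g _) (increment-ext n f≡g)

hℕ : ℕ → ℕ
hℕ = <-rec (λ _ → ℕ) hStep

hℕ-unfold : ∀ n → hℕ n ≡ hStep n (λ {m} _ → hℕ m)
hℕ-unfold n = FixPoint.unfold-wfRec <-wellFounded (λ _ → ℕ) hStep hStep-ext {n}

hℕ-recurrence : ∀ n → hℕ (2 ℕ.+ n) ≡ hℕ n ℕ.+ increment n (λ {m} _ → hℕ m)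
hℕ-recurrence n = hℕ-unfold (2 ℕ.+ n)

hℕ-positive : ∀ n → 1 ℕ.≤ hℕ n
hℕ-positive zero          = ℕP.≤-reflexive (sym (hℕ-unfold 0))
hℕ-positive (suc zero)    = ℕP.≤-reflexive (sym (hℕ-unfold 1))
hℕ-positive (suc (suc n)) = subst (1 ℕ.≤_) (sym (hℕ-recurrence n)) (ℕP.≤-trans (hℕ-positive n) (ℕP.m≤m+n _ _))

hℕ≥2 : ∀ n → 2 ℕ.≤ hℕ (2 ℕ.+ n)
hℕ≥2 n = subst (2 ℕ.≤_) (sym (hℕ-recurrence n))
  (ℕP.+-mono-≤ (hℕ-positive n) (increment-positive hℕ hℕ-positive n))

2+[j+j]≡[1+j]+[1+j] : ∀ j → 2 ℕ.+ (j ℕ.+ j) ≡ suc j ℕ.+ suc j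
2+[j+j]≡[1+j]+[1+j] j = cong suc (sym (ℕP.+-suc j j))

parity : ∀ n → (∃[ j ] n ≡ j ℕ.+ j) ⊎ (∃[ j ] n ≡ suc (j ℕ.+ j))
parity zero = inj₁ (0 , refl)
parity (suc n) with parity n
... | inj₁ (j , refl) = inj₂ (j , refl)
... | inj₂ (j , refl) = inj₁ (suc j , 2+[j+j]≡[1+j]+[1+j] j)

hℕ-odd : ∀ j → hℕ (suc (j ℕ.+ j)) ≡ suc j
hℕ-odd zero    = hℕ-unfold 1
hℕ-odd (suc j) = begin
  hℕ (suc (suc j ℕ.+ suc j))                   ≡⟨ cong (hℕ ∘ suc) (sym (2+[j+j]≡[1+j]+[1+j] j)) ⟩
  hℕ (2 ℕ.+ suc (j ℕ.+ j))                     ≡⟨ hℕ-recurrence (suc (j ℕ.+ j)) ⟩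
  hℕ (suc (j ℕ.+ j)) ℕ.+ increment (suc (j ℕ.+ j)) (λ {m} _ → hℕ m)
    ≡⟨ cong₂ ℕ._+_ (hℕ-odd j) (increment-odd hℕ j) ⟩
  suc j ℕ.+ 1                                  ≡⟨ ℕP.+-comm (suc j) 1 ⟩
  suc (suc j)                                  ∎
  where open ≡-Reasoning

hℕ-even : ∀ j → hℕ (2 ℕ.+ (j ℕ.+ j)) ≡ hℕ (suc j) ℕ.+ hℕ (j ℕ.+ j)
hℕ-even j = begin
  hℕ (2 ℕ.+ (j ℕ.+ j))                                           ≡⟨ hℕ-recurrence (j ℕ.+ j) ⟩
  hℕ (j ℕ.+ j) ℕ.+ increment (j ℕ.+ j) (λ {m} _ → hℕ m)          ≡⟨ cong (hℕ (j ℕ.+ j) ℕ.+_) (increment-even hℕ j) ⟩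
  hℕ (j ℕ.+ j) ℕ.+ hℕ (suc j)                                    ≡⟨ ℕP.+-comm (hℕ (j ℕ.+ j)) _ ⟩
  hℕ (suc j) ℕ.+ hℕ (j ℕ.+ j)                                    ∎
  where open ≡-Reasoning

hℕ-even-lower-bound : ∀ j → 2 ℕ.+ (j ℕ.+ j) ℕ.≤ hℕ (2 ℕ.+ (j ℕ.+ j))
hℕ-even-lower-bound zero    = hℕ≥2 0
hℕ-even-lower-bound (suc j) = begin
  2 ℕ.+ (suc j ℕ.+ suc j)                      ≡⟨ cong (2 ℕ.+_) (sym (2+[j+j]≡[1+j]+[1+j] j)) ⟩
  2 ℕ.+ (2 ℕ.+ (j ℕ.+ j))                      ≤⟨ ℕP.+-mono-≤ (hℕ≥2 j) (hℕ-even-lower-bound j) ⟩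
  hℕ (2 ℕ.+ j) ℕ.+ hℕ (2 ℕ.+ (j ℕ.+ j))        ≡⟨ cong (λ m → hℕ (2 ℕ.+ j) ℕ.+ hℕ m) (2+[j+j]≡[1+j]+[1+j] j) ⟩
  hℕ (2 ℕ.+ j) ℕ.+ hℕ (suc j ℕ.+ suc j)        ≡⟨ sym (hℕ-even (suc j)) ⟩
  hℕ (2 ℕ.+ (suc j ℕ.+ suc j))                 ∎
  where open ℕP.≤-Reasoning

hℕ-series-recurrence : ∀ n →
  + hℕ (2 ℕ.+ n) ≡ sq (λ k → + hℕ k) (2 ℕ.+ n) + + hℕ n + inv1-x² (suc n)
hℕ-series-recurrence n = begin
  + hℕ (2 ℕ.+ n)                                            ≡⟨ cong +_ (hℕ-recurrence n) ⟩
  + hℕ n + + increment n (λ {m} _ → hℕ m)                   ≡⟨ cong (_+_ (+ hℕ n)) (increment-sq hℕ n) ⟩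
  + hℕ n + (sq (λ k → + hℕ k) (2 ℕ.+ n) + inv1-x² (suc n))  ≡⟨ rearrange (+ hℕ n) (sq (λ k → + hℕ k) (2 ℕ.+ n)) (inv1-x² (suc n)) ⟩
  sq (λ k → + hℕ k) (2 ℕ.+ n) + + hℕ n + inv1-x² (suc n)    ∎
  where
  open ≡-Reasoning
  rearrange : ∀ a b c → a + (b + c) ≡ b + a + c
  rearrange = solve-∀

hℤ : ℤ → ℤ
hℤ (+ n)    = + hℕ n
hℤ -[1+ _ ] = 1ℤ

hℤ-initial : ∀ n → n ≤ 1ℤ → hℤ n ≡ 1ℤ
hℤ-initial (+ zero)          _                  = cong +_ (hℕ-unfold 0)
hℤ-initial (+ suc zero)      _                  = cong +_ (hℕ-unfold 1)
hℤ-initial (+ suc (suc n))   (+≤+ (s≤s ()))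
hℤ-initial -[1+ _ ]          _                  = refl

[1+n]-m≤1 : ∀ {n m} → n ℕ.≤ m → + suc n - + m ≤ 1ℤ
[1+n]-m≤1 {n} {m} n≤m = begin
  + suc n - + m        ≡⟨ ℤP.+-assoc 1ℤ (+ n) (- + m) ⟩
  1ℤ + (+ n - + m)     ≤⟨ ℤP.+-monoʳ-≤ 1ℤ (ℤP.i≤j⇒i-j≤0 (+≤+ n≤m)) ⟩
  1ℤ                   ∎
  where open ℤP.≤-Reasoning

[n+n]-n≡n : ∀ n → + (n ℕ.+ n) - + n ≡ + n
[n+n]-n≡n n = i+j-j≡i (+ n) (+ n)
  where
  i+j-j≡i : ∀ i j → i + j - j ≡ i
  i+j-j≡i = solve-∀

hℤ-recurrence-even : ∀ j →
  hℤ (+ (2 ℕ.+ (j ℕ.+ j))) ≡ hℤ (+ (2 ℕ.+ (j ℕ.+ j)) - hℤ (+ suc (j ℕ.+ j))) + hℤ (+ (j ℕ.+ j))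
hℤ-recurrence-even j = begin
  + hℕ (2 ℕ.+ (j ℕ.+ j))                                         ≡⟨ cong +_ (hℕ-even j) ⟩
  + hℕ (suc j) + + hℕ (j ℕ.+ j)
    ≡⟨ cong (λ i → hℤ i + + hℕ (j ℕ.+ j)) (sym ([n+n]-n≡n (suc j))) ⟩
  hℤ (+ (suc j ℕ.+ suc j) - + suc j) + + hℕ (j ℕ.+ j)
    ≡⟨ cong₂ (λ m i → hℤ (+ m - i) + + hℕ (j ℕ.+ j)) (sym (2+[j+j]≡[1+j]+[1+j] j)) (cong +_ (sym (hℕ-odd j))) ⟩
  hℤ (+ (2 ℕ.+ (j ℕ.+ j)) - + hℕ (suc (j ℕ.+ j))) + + hℕ (j ℕ.+ j) ∎
  where open ≡-Reasoning

hℤ-recurrence-odd : ∀ j →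
  hℤ (+ (3 ℕ.+ (j ℕ.+ j))) ≡ hℤ (+ (3 ℕ.+ (j ℕ.+ j)) - hℤ (+ (2 ℕ.+ (j ℕ.+ j)))) + hℤ (+ suc (j ℕ.+ j))
hℤ-recurrence-odd j = begin
  + hℕ (suc (2 ℕ.+ (j ℕ.+ j)))                   ≡⟨ cong (+_ ∘ hℕ ∘ suc) (2+[j+j]≡[1+j]+[1+j] j) ⟩
  + hℕ (suc (suc j ℕ.+ suc j))                   ≡⟨ cong +_ (hℕ-odd (suc j)) ⟩
  1ℤ + + suc j
    ≡⟨ cong₂ _+_ (sym (hℤ-initial _ ([1+n]-m≤1 (hℕ-even-lower-bound j)))) (cong +_ (sym (hℕ-odd j))) ⟩
  hℤ (+ (3 ℕ.+ (j ℕ.+ j)) - + hℕ (2 ℕ.+ (j ℕ.+ j))) + + hℕ (suc (j ℕ.+ j)) ∎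
  where open ≡-Reasoning

hℤ-recurrence : ∀ n → 1ℤ < n → hℤ n ≡ hℤ (n - hℤ (n - 1ℤ)) + hℤ (n - + 2)
hℤ-recurrence (+ zero)        (+<+ ())
hℤ-recurrence (+ suc zero)    (+<+ (s≤s ()))
hℤ-recurrence (+ suc (suc k)) _ with parity k
... | inj₁ (j , refl) = hℤ-recurrence-even j
... | inj₂ (j , refl) = hℤ-recurrence-odd j

hℤ-IsH : IsH hℤ
hℤ-IsH = hℤ-initial , hℤ-recurrence

[1+n]-i≤n : ∀ n {i} → 1ℤ ≤ i → + suc n - i ≤ + n
[1+n]-i≤n n {+ suc c} (+≤+ (s≤s _)) =
  subst (_≤ + n) (sym (ℤP.[1+m]⊖[1+n]≡m⊖n n c)) (ℤP.m⊖n≤m n c)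

IsH-unique : ∀ {h h′ : ℤ → ℤ} → IsH h → IsH h′ → (∀ n → 1ℤ ≤ h′ (+ n)) → ∀ n → h (+ n) ≡ h′ (+ n)
IsH-unique {h} {h′} (h-initial , h-rec) (h′-initial , h′-rec) h′-positive = <-rec _ agree
  where
  open ≡-Reasoning

  agree : ∀ n → (∀ {m} → m ℕ.< n → h (+ m) ≡ h′ (+ m)) → h (+ n) ≡ h′ (+ n)
  agree zero          _  = trans (h-initial _ (+≤+ z≤n)) (sym (h′-initial _ (+≤+ z≤n)))
  agree (suc zero)    _  = trans (h-initial _ ℤP.≤-refl) (sym (h′-initial _ ℤP.≤-refl))
  agree (suc (suc k)) ih = begin
    h (+ suc (suc k))                                  ≡⟨ h-rec _ 1<2+k ⟩
    h (+ suc (suc k) - h (+ suc k)) + h (+ k)          ≡⟨ cong₂ (λ i j → h (+ suc (suc k) - i) + j) ih₁ ih₀ ⟩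
    h (+ suc (suc k) - h′ (+ suc k)) + h′ (+ k)
      ≡⟨ cong (_+ h′ (+ k)) (agree-below ([1+n]-i≤n (suc k) (h′-positive (suc k)))) ⟩
    h′ (+ suc (suc k) - h′ (+ suc k)) + h′ (+ k)       ≡⟨ sym (h′-rec _ 1<2+k) ⟩
    h′ (+ suc (suc k))                                 ∎
    where
    1<2+k : 1ℤ < + suc (suc k)
    1<2+k = +<+ (s≤s (s≤s z≤n))
    ih₁ : h (+ suc k) ≡ h′ (+ suc k)
    ih₁ = ih ℕP.≤-refl
    ih₀ : h (+ k) ≡ h′ (+ k)
    ih₀ = ih (ℕP.m<n⇒m<1+n ℕP.≤-refl)
    agree-below : ∀ {i} → i ≤ + suc k → h i ≡ h′ i
    agree-below {+ m}     (+≤+ m≤1+k) = ih (s≤s m≤1+k)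
    agree-below { -[1+ _ ]} _         = trans (h-initial _ -≤+) (sym (h′-initial _ -≤+))

GF-recurrence : ∀ {h} → IsH h → ∀ n → GF h (2 ℕ.+ n) ≡ sq (GF h) (2 ℕ.+ n) + GF h n + inv1-x² (suc n)
GF-recurrence {h} isH n = begin
  GF h (2 ℕ.+ n)                                                 ≡⟨ h≡hℤ (2 ℕ.+ n) ⟩
  + hℕ (2 ℕ.+ n)                                                 ≡⟨ hℕ-series-recurrence n ⟩
  sq (GF hℤ) (2 ℕ.+ n) + + hℕ n + inv1-x² (suc n)
    ≡⟨ cong₂ (λ a b → a + b + inv1-x² (suc n)) (sym (sq-cong h≡hℤ (2 ℕ.+ n))) (sym (h≡hℤ n)) ⟩
  sq (GF h) (2 ℕ.+ n) + GF h n + inv1-x² (suc n)                 ∎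
  where
  open ≡-Reasoning
  h≡hℤ : GF h ≈PS GF hℤ
  h≡hℤ = IsH-unique isH hℤ-IsH (λ n → +≤+ (hℕ-positive n))

theorem3p5 : Σ (ℤ → ℤ) IsH
    × (∀ (h : ℤ → ℤ) → IsH h →
    (((inv1-x² ⊛ sq (GF h)) ⊕ (⊖ GF h)) ⊕ ((X ⊛ inv1-x²) ⊛ inv1-x²)) ≈PS zeroPS)
theorem3p5 = (hℤ , hℤ-IsH) , λ h isH →
  series-identity (GF h) (proj₁ isH _ (+≤+ z≤n)) (proj₁ isH _ ℤP.≤-refl) (GF-recurrence isH)
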